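{- There exists a positive constant $C_3$ such that for every integer $\ell \ge 0$ there exist reduced expressions $u, v$ of length $\ell$ (over $\{\sigma_1,\dots,\sigma_{n-1}\}$ for some $n$) satisfying $\operatorname{rc}(u,v) \ge C_3\,\ell^4$.
   Context: For $1\le i\le n-1$, $\sigma_i$ is the transposition exchanging $i$ and $i+1$; an expression is a word in the letters $\sigma_i$, representing the product of its letters read left to right; it is reduced if no shorter word represents the same permutation. Introduce formal letters $\bar\sigma_i$; for a word $w$ in letters $\sigma_i,\bar\sigma_i$, $\bar w$ is obtained by reversing the order of the letters and exchanging $\sigma_i\leftrightarrow\bar\sigma_i$. One writes $w \curvearrowright w'$ if $w'$ is obtained from $w$ by replacing one subword $\bar\sigma_i\sigma_j$ by $\sigma_j\sigma_i\bar\sigma_j\bar\sigma_i$ if $|i-j|=1$ (step of type I), by $\sigma_j\bar\sigma_i$ if $|i-j|\ge 2$ (type II), or by the empty word if $i=j$ (type III). A reversing sequence is a sequence $w_0 \curvearrowright w_1\curvearrowright\cdots$. For reduced expressions $u,v$, a reversing sequence starting from $\bar u v$ always terminates in a word of the form $v'\bar{u'}$ with $u',v'$ expressions (no subword $\bar\sigma_i\sigma_j$ remains), and the number of steps of type I or II in such a terminating sequence does not depend on the choice of sequence; this number is the reversing complexity $\operatorname{rc}(u,v)$. -}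

module Defs where

open import Data.Nat using (ℕ; suc; _≤_; _<_; ∣_-_∣)
open import Data.List using (List; []; _∷_; _++_; reverse; map; length)
open import Data.List.Relation.Unary.All using (All)
open import Data.Product using (Σ; _×_; ∃; ∃-syntax)
open import Relation.Nullary using (¬_)
open import Relation.Binary.PropositionalEquality using (_≡_)
open import Data.Nat using (_≟_)
open import Relation.Nullary using (yes; no)

transp : ℕ → ℕ → ℕ
transp i x with x ≟ i
... | yes _ = suc i
... | no _ with x ≟ suc i
...   | yes _ = i
...   | no _ = x

-- an expression is a list of indices i (standing for σ_i);
-- eval w is the permutation represented by w (product read left to right:
-- the first letter is applied first)
eval : List ℕ → ℕ → ℕ
eval [] x = x
eval (i ∷ w) x = eval w (transp i x)

IsExpr : ℕ → List ℕ → Set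
IsExpr n w = All (λ i → 1 ≤ i × i < n) w

Reduced : ℕ → List ℕ → Set
Reduced n u = IsExpr n u ×
  (∀ (w : List ℕ) → IsExpr n w → (∀ x → eval w x ≡ eval u x) → length u ≤ length w)

data Letter : Set where
  σ  : ℕ → Letter
  σ̄ : ℕ → Letter

bar-letter : Letter → Letter
bar-letter (σ i) = σ̄ i
bar-letter (σ̄ i) = σ i

bar : List Letter → List Letter
bar w = reverse (map bar-letter w)

-- one reversing step; the ℕ index is 1 for steps of type I or II, 0 for type III
data Step : List Letter → List Letter → ℕ → Set where
  typeI   : ∀ x y i j → ∣ i - j ∣ ≡ 1 →
            Step (x ++ σ̄ i ∷ σ j ∷ y) (x ++ σ j ∷ σ i ∷ σ̄ j ∷ σ̄ i ∷ y) 1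
  typeII  : ∀ x y i j → 2 ≤ ∣ i - j ∣ →
            Step (x ++ σ̄ i ∷ σ j ∷ y) (x ++ σ j ∷ σ̄ i ∷ y) 1
  typeIII : ∀ x y i →
            Step (x ++ σ̄ i ∷ σ i ∷ y) (x ++ y) 0

data Reversing : List Letter → List Letter → ℕ → Set where
  done : ∀ {w} → Reversing w w 0
  step : ∀ {w w₁ w₂ a b} → Step w w₁ a → Reversing w₁ w₂ b →
         Reversing w w₂ (a Data.Nat.+ b)

Terminal : List Letter → Set
Terminal w = ¬ (∃[ x ] ∃[ y ] ∃[ i ] ∃[ j ] (w ≡ x ++ σ̄ i ∷ σ j ∷ y))

-- RC u v k : some terminating reversing sequence from ū v has exactly k steps
-- of type I or II, i.e. rc(u,v) = k (well defined: independent of the sequence)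
RC : List ℕ → List ℕ → ℕ → Set
RC u v k = ∃[ w' ] (Reversing (bar (map σ u) ++ map σ v) w' k × Terminal w')

module Submission where

-- For ℓ ≥ 0 take  u = σ_{ℓ+1} σ_{ℓ+2} ⋯ σ_{2ℓ}  and  v = σ_ℓ σ_{ℓ-1} ⋯ σ_1  in S_{2ℓ+1}.
-- Both are reduced, because each letter moves a point by at most one while u sends
-- ℓ+1 to 2ℓ+1 and v sends ℓ+1 to 1.  Reversing ū v is organised as a grid: a
-- reversing "cell" takes ū v to v' ū'; cells glue horizontally and vertically, the
-- step counts adding up.  Reversing the letter σ̄_c of u against an ascending run
-- σ_t ⋯ σ_{t+p} (with c = t+p+1) costs p+1 steps and lengthens the run by one, so
-- after the i-th letter of u has crossed them, v has become ℓ ascending runs of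
-- length i+1; the i-th row therefore costs i·(1+2+⋯+ℓ).  In total
-- rc(u,v) = T(ℓ)² with T(ℓ) = ℓ(ℓ+1)/2, which is at least ℓ⁴/4.

open import Defs

module Construction where

  open import Data.Nat using (ℕ; zero; suc; _+_; _*_; _^_; _≤_; _<_; z≤n; s≤s; ∣_-_∣; _≟_)
  open import Data.Nat.Properties
    using (+-suc; +-comm; +-assoc; *-zeroʳ; ≤-refl; ≤-trans; ≤-pred; m≤m+n; m≤n+m; n≤1+n; m<n⇒m<1+n;
           +-monoʳ-≤; +-cancelʳ-≤; *-mono-≤; *-identityʳ; *-distribʳ-+; 1+n≢n)
  open import Data.Nat.Tactic.RingSolver using (solve-∀)
  open import Data.List using (List; []; _∷_; _++_; reverse; map; length)
  open import Data.List.Properties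
    using (++-assoc; ++-identityʳ; map-++; map-∘; reverse-++; reverse-map; length-++; ∷-injectiveʳ)
  open import Data.List.Relation.Unary.All using (All; []; _∷_)
  import Data.List.Relation.Unary.All as All
  open import Data.List.Relation.Unary.All.Properties using (++⁺)
  open import Data.Product using (_×_; _,_; proj₂; ∃-syntax)
  open import Data.Empty using (⊥-elim)
  open import Relation.Nullary using (yes; no)
  open import Relation.Binary.PropositionalEquality

  private
    variable
      w w' w₁ w₂ : List Letter
      a k k₁ k₂ : ℕ

  _▸_ : Reversing w₁ w k₁ → Reversing w w₂ k₂ → Reversing w₁ w₂ (k₁ + k₂)
  done ▸ r = r
  _▸_ {w₂ = w₂} {k₂ = k₂} (step {w = w₁} {a = a} {b = b} s r) r' =
    subst (Reversing w₁ w₂) (sym (+-assoc a b k₂)) (step s (r ▸ r'))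

  recast : w₁ ≡ w → w₂ ≡ w' → Reversing w₁ w₂ k → Reversing w w' k
  recast refl refl r = r

  step-prefix : ∀ z → Step w w' a → Step (z ++ w) (z ++ w') a
  step-prefix z (typeI x y i j d) =
    subst₂ (λ p q → Step p q 1) (++-assoc z x _) (++-assoc z x _) (typeI (z ++ x) y i j d)
  step-prefix z (typeII x y i j d) =
    subst₂ (λ p q → Step p q 1) (++-assoc z x _) (++-assoc z x _) (typeII (z ++ x) y i j d)
  step-prefix z (typeIII x y i) =
    subst₂ (λ p q → Step p q 0) (++-assoc z x _) (++-assoc z x _) (typeIII (z ++ x) y i)

  step-suffix : ∀ z → Step w w' a → Step (w ++ z) (w' ++ z) a
  step-suffix z (typeI x y i j d) =
    subst₂ (λ p q → Step p q 1) (sym (++-assoc x _ z)) (sym (++-assoc x _ z)) (typeI x (y ++ z) i j d)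
  step-suffix z (typeII x y i j d) =
    subst₂ (λ p q → Step p q 1) (sym (++-assoc x _ z)) (sym (++-assoc x _ z)) (typeII x (y ++ z) i j d)
  step-suffix z (typeIII x y i) =
    subst₂ (λ p q → Step p q 0) (sym (++-assoc x _ z)) (sym (++-assoc x _ z)) (typeIII x (y ++ z) i)

  reversing-prefix : ∀ z → Reversing w w' k → Reversing (z ++ w) (z ++ w') k
  reversing-prefix z done = done
  reversing-prefix z (step s r) = step (step-prefix z s) (reversing-prefix z r)

  reversing-suffix : ∀ z → Reversing w w' k → Reversing (w ++ z) (w' ++ z) k
  reversing-suffix z done = done
  reversing-suffix z (step s r) = step (step-suffix z s) (reversing-suffix z r)

  barred : List ℕ → List Letter
  barred U = map σ̄ (reverse U)

  barred-++ : ∀ U₁ U₂ → barred (U₁ ++ U₂) ≡ barred U₂ ++ barred U₁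
  barred-++ U₁ U₂ = trans (cong (map σ̄) (reverse-++ U₁ U₂)) (map-++ σ̄ (reverse U₂) (reverse U₁))

  -- A reversing grid with left side U, top V, bottom V' and right side U':
  -- ū v reverses to v' ū' using k steps of type I or II.
  record Grid (U V V' U' : List ℕ) (k : ℕ) : Set where
    constructor grid
    field reversal : Reversing (barred U ++ map σ V) (map σ V' ++ barred U') k

  beside : ∀ {U V₁ V₁' U₁ V₂ V₂' U₂} →
           Grid U V₁ V₁' U₁ k₁ → Grid U₁ V₂ V₂' U₂ k₂ →
           Grid U (V₁ ++ V₂) (V₁' ++ V₂') U₂ (k₁ + k₂)
  beside {U = U} {V₁} {V₁'} {U₁} {V₂} {V₂'} {U₂} (grid r₁) (grid r₂) =
    grid (recast start middle (reversing-suffix (map σ V₂) r₁)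
          ▸ recast refl end (reversing-prefix (map σ V₁') r₂))
    where
    start : (barred U ++ map σ V₁) ++ map σ V₂ ≡ barred U ++ map σ (V₁ ++ V₂)
    start = trans (++-assoc (barred U) _ _) (cong (barred U ++_) (sym (map-++ σ V₁ V₂)))
    middle : (map σ V₁' ++ barred U₁) ++ map σ V₂ ≡ map σ V₁' ++ (barred U₁ ++ map σ V₂)
    middle = ++-assoc (map σ V₁') _ _
    end : map σ V₁' ++ (map σ V₂' ++ barred U₂) ≡ map σ (V₁' ++ V₂') ++ barred U₂
    end = trans (sym (++-assoc (map σ V₁') _ _)) (cong (_++ barred U₂) (sym (map-++ σ V₁' V₂')))

  above : ∀ {U₁ V V₁ U₁' U₂ V₂ U₂'} →
          Grid U₁ V V₁ U₁' k₁ → Grid U₂ V₁ V₂ U₂' k₂ →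
          Grid (U₁ ++ U₂) V V₂ (U₁' ++ U₂') (k₁ + k₂)
  above {U₁ = U₁} {V} {V₁} {U₁'} {U₂} {V₂} {U₂'} (grid r₁) (grid r₂) =
    grid (recast start middle (reversing-prefix (barred U₂) r₁)
          ▸ recast refl end (reversing-suffix (barred U₁') r₂))
    where
    start : barred U₂ ++ (barred U₁ ++ map σ V) ≡ barred (U₁ ++ U₂) ++ map σ V
    start = trans (sym (++-assoc (barred U₂) _ _)) (cong (_++ map σ V) (sym (barred-++ U₁ U₂)))
    middle : barred U₂ ++ (map σ V₁ ++ barred U₁') ≡ (barred U₂ ++ map σ V₁) ++ barred U₁'
    middle = sym (++-assoc (barred U₂) _ _)
    end : (map σ V₂ ++ barred U₂') ++ barred U₁' ≡ map σ V₂ ++ barred (U₁' ++ U₂')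
    end = trans (++-assoc (map σ V₂) _ _) (cong (map σ V₂ ++_) (sym (barred-++ U₁' U₂')))

  regrid : ∀ {U V V₁ V₂ U'} → V₁ ≡ V₂ → k₁ ≡ k₂ → Grid U V V₁ U' k₁ → Grid U V V₂ U' k₂
  regrid refl refl g = g

  empty-left : ∀ V → Grid [] V V [] 0
  empty-left V = grid (recast refl (sym (++-identityʳ (map σ V))) done)

  cell-I : ∀ i j → ∣ i - j ∣ ≡ 1 → Grid (i ∷ []) (j ∷ []) (j ∷ i ∷ []) (i ∷ j ∷ []) 1
  cell-I i j d = grid (step (typeI [] [] i j d) done)

  cell-II : ∀ i j → 2 ≤ ∣ i - j ∣ → Grid (i ∷ []) (j ∷ []) (j ∷ []) (i ∷ []) 1
  cell-II i j d = grid (step (typeII [] [] i j d) done)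

  commute-column : ∀ c V → All (λ x → 2 ≤ ∣ c - x ∣) V → Grid (c ∷ []) V V (c ∷ []) (length V)
  commute-column c [] [] = grid (recast refl (sym (++-identityʳ _)) done)
  commute-column c (x ∷ V) (d ∷ ds) = beside (cell-II c x d) (commute-column c V ds)

  adjacent : ∀ x → ∣ suc x - x ∣ ≡ 1
  adjacent zero = refl
  adjacent (suc x) = adjacent x

  far-below : ∀ x c → suc (suc x) ≤ c → 2 ≤ ∣ c - x ∣
  far-below zero (suc (suc c)) (s≤s (s≤s _)) = s≤s (s≤s z≤n)
  far-below (suc x) (suc c) (s≤s h) = far-below x c h

  asc : ℕ → ℕ → List ℕ
  asc s zero = []
  asc s (suc p) = asc s p ++ (p + s ∷ [])

  stair : ℕ → ℕ → ℕ → List ℕ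
  stair s m zero = []
  stair s m (suc q) = asc (s + q) m ++ stair s m q

  length-asc : ∀ s p → length (asc s p) ≡ p
  length-asc s zero = refl
  length-asc s (suc p) = trans (length-++ (asc s p)) (trans (cong (_+ 1) (length-asc s p)) (+-comm p 1))

  length-stair : ∀ s m q → length (stair s m q) ≡ q * m
  length-stair s m zero = refl
  length-stair s m (suc q) =
    trans (length-++ (asc (s + q) m)) (cong₂ _+_ (length-asc (s + q) m) (length-stair s m q))

  asc-range : ∀ s p → All (λ x → s ≤ x × x < p + s) (asc s p)
  asc-range s zero = []
  asc-range s (suc p) =
    ++⁺ (All.map (λ (lo , hi) → lo , m<n⇒m<1+n hi) (asc-range s p)) ((m≤n+m s p , ≤-refl) ∷ [])

  shift : ∀ m s q → m + (s + suc q) ≡ suc (m + (s + q))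
  shift m s q = trans (cong (m +_) (+-suc s q)) (+-suc m (s + q))

  stair-range : ∀ s m q → All (λ x → s ≤ x × suc x < m + (s + q)) (stair s m q)
  stair-range s m zero = []
  stair-range s m (suc q) =
    ++⁺ (All.map (λ {x} (lo , hi) → ≤-trans (m≤m+n s q) lo , subst (suc x <_) (sym (shift m s q)) (s≤s hi))
                 (asc-range (s + q) m))
        (All.map (λ {x} (lo , hi) → lo , subst (suc x <_) (sym (shift m s q)) (m<n⇒m<1+n hi))
                 (stair-range s m q))

  -- σ̄_c with c = t+p+1 crosses the run σ_t ⋯ σ_{t+p}: it commutes past the first
  -- p letters and meets σ_{t+p} in one type I step, so the run grows by σ_c.
  run-cell : ∀ t p c → c ≡ suc p + t →
             Grid (c ∷ []) (asc t (suc p)) (asc t (suc (suc p))) (c ∷ p + t ∷ []) (suc p)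
  run-cell t p .(suc p + t) refl =
    regrid (sym (++-assoc (asc t p) _ _)) (trans (cong (_+ 1) (length-asc t p)) (+-comm p 1))
      (beside (commute-column (suc p + t) (asc t p)
                 (All.map (λ (_ , hi) → far-below _ _ (s≤s hi)) (asc-range t p)))
              (cell-I (suc p + t) (p + t) (adjacent (p + t))))

  tri : ℕ → ℕ
  tri zero = 0
  tri (suc n) = suc n + tri n

  row : ∀ s p q → ∃[ U' ] Grid (p + (s + q) ∷ []) (stair s (suc p) q) (stair s (suc (suc p)) q) U'
                               (suc p * tri q)
  row s p zero = _ , regrid refl (sym (*-zeroʳ p)) (commute-column _ [] [])
  row s p (suc q) =
    let U' , rest = row s p q in
    c ∷ U' ,
    regrid refl (count (length-stair s (suc p) q))
      (beside (run-cell (s + q) p c (shift p s q))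
              (above (commute-column c (stair s (suc p) q) far) rest))
    where
    c : ℕ
    c = p + (s + suc q)
    far : All (λ x → 2 ≤ ∣ c - x ∣) (stair s (suc p) q)
    far = All.map (λ {x} (_ , hi) → far-below x c (subst (suc (suc x) ≤_) (sym (shift p s q)) hi))
                  (stair-range s (suc p) q)
    count : ∀ {n} → n ≡ q * suc p → suc p + (n + suc p * tri q) ≡ suc p * tri (suc q)
    count refl = lemma p q (tri q)
      where
      lemma : ∀ p q t → suc p + (q * suc p + suc p * t) ≡ suc p * (suc q + t)
      lemma = solve-∀

  staircase : ∀ s p q → ∃[ U' ] Grid (asc (s + q) p) (stair s 1 q) (stair s (suc p) q) U'
                                     (tri p * tri q)
  staircase s zero q = [] , empty-left (stair s 1 q)
  staircase s (suc p) q =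
    let U₁ , top = staircase s p q
        U₂ , bottom = row s p q
    in U₁ ++ U₂ ,
       regrid refl (trans (+-comm (tri p * tri q) _) (sym (*-distribʳ-+ (tri q) (suc p) (tri p))))
         (above top bottom)

  σσ̄-terminal : ∀ A B x y i j → map σ A ++ map σ̄ B ≢ x ++ σ̄ i ∷ σ j ∷ y
  σσ̄-terminal (a ∷ A) B [] y i j ()
  σσ̄-terminal [] [] [] y i j ()
  σσ̄-terminal [] (b ∷ []) [] y i j ()
  σσ̄-terminal [] (b ∷ b' ∷ B) [] y i j ()
  σσ̄-terminal (a ∷ A) B (z ∷ x) y i j eq = σσ̄-terminal A B x y i j (∷-injectiveʳ eq)
  σσ̄-terminal [] [] (z ∷ x) y i j ()
  σσ̄-terminal [] (b ∷ B) (z ∷ x) y i j eq = σσ̄-terminal [] B x y i j (∷-injectiveʳ eq)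

  bar-map-σ : ∀ U → bar (map σ U) ≡ barred U
  bar-map-σ U = trans (cong reverse (sym (map-∘ U))) (sym (reverse-map σ̄ U))

  grid⇒RC : ∀ {U V V' U'} → Grid U V V' U' k → RC U V k
  grid⇒RC {U = U} {V} {V'} {U'} (grid r) =
    map σ V' ++ barred U' ,
    recast (cong (_++ map σ V) (sym (bar-map-σ U))) refl r ,
    λ (x , y , i , j , eq) → σσ̄-terminal V' (reverse U') x y i j eq

  transp-self : ∀ i → transp i i ≡ suc i
  transp-self i with i ≟ i
  ... | yes _ = refl
  ... | no i≢i = ⊥-elim (i≢i refl)

  transp-suc : ∀ i → transp i (suc i) ≡ i
  transp-suc i with suc i ≟ i
  ... | yes eq = ⊥-elim (1+n≢n eq)
  ... | no _ with suc i ≟ suc i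
  ...   | yes _ = refl
  ...   | no i≢i = ⊥-elim (i≢i refl)

  transp-≤ : ∀ i x → transp i x ≤ suc x
  transp-≤ i x with x ≟ i
  ... | yes refl = ≤-refl
  ... | no _ with x ≟ suc i
  ...   | yes refl = ≤-trans (n≤1+n i) (n≤1+n (suc i))
  ...   | no _ = n≤1+n x

  transp-≥ : ∀ i x → x ≤ suc (transp i x)
  transp-≥ i x with x ≟ i
  ... | yes refl = ≤-trans (n≤1+n i) (n≤1+n (suc i))
  ... | no _ with x ≟ suc i
  ...   | yes refl = ≤-refl
  ...   | no _ = n≤1+n x

  eval-≤ : ∀ w x → eval w x ≤ length w + x
  eval-≤ [] x = ≤-refl
  eval-≤ (i ∷ w) x = ≤-trans (eval-≤ w (transp i x))
    (subst (length w + transp i x ≤_) (+-suc (length w) x) (+-monoʳ-≤ (length w) (transp-≤ i x)))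

  eval-≥ : ∀ w x → x ≤ length w + eval w x
  eval-≥ [] x = ≤-refl
  eval-≥ (i ∷ w) x = ≤-trans (transp-≥ i x) (s≤s (eval-≥ w (transp i x)))

  reduced-if-raises : ∀ n u x → IsExpr n u → eval u x ≡ length u + x → Reduced n u
  reduced-if-raises n u x e raises = e , λ w _ same →
    +-cancelʳ-≤ x (length u) (length w)
      (subst (_≤ length w + x) (trans (same x) raises) (eval-≤ w x))

  reduced-if-lowers : ∀ n u y → IsExpr n u → eval u (length u + y) ≡ y → Reduced n u
  reduced-if-lowers n u y e lowers = e , λ w _ same →
    +-cancelʳ-≤ y (length u) (length w)
      (subst (λ z → length u + y ≤ length w + z) (trans (same _) lowers) (eval-≥ w (length u + y)))

  eval-++ : ∀ w w' x → eval (w ++ w') x ≡ eval w' (eval w x)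
  eval-++ [] w' x = refl
  eval-++ (i ∷ w) w' x = eval-++ w w' (transp i x)

  eval-asc : ∀ s p → eval (asc s p) s ≡ p + s
  eval-asc s zero = refl
  eval-asc s (suc p) = trans (eval-++ (asc s p) _ s)
    (trans (cong (eval (p + s ∷ [])) (eval-asc s p)) (transp-self (p + s)))

  eval-descent : ∀ q → eval (stair 1 1 q) (suc q) ≡ 1
  eval-descent zero = refl
  eval-descent (suc q) = trans (cong (eval (stair 1 1 q)) (transp-suc (suc q))) (eval-descent q)

  u-word v-word : ℕ → List ℕ
  u-word ℓ = asc (suc ℓ) ℓ
  v-word ℓ = stair 1 1 ℓ

  length-v : ∀ ℓ → length (v-word ℓ) ≡ ℓ
  length-v ℓ = trans (length-stair 1 1 ℓ) (*-identityʳ ℓ)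

  u-reduced : ∀ ℓ → Reduced (suc (ℓ + ℓ)) (u-word ℓ)
  u-reduced ℓ = reduced-if-raises _ _ (suc ℓ)
    (All.map (λ {x} (lo , hi) → ≤-trans (s≤s z≤n) lo , subst (x <_) (+-suc ℓ ℓ) hi) (asc-range (suc ℓ) ℓ))
    (trans (eval-asc (suc ℓ) ℓ) (cong (_+ suc ℓ) (sym (length-asc (suc ℓ) ℓ))))

  v-reduced : ∀ ℓ → Reduced (suc (ℓ + ℓ)) (v-word ℓ)
  v-reduced ℓ = reduced-if-lowers _ _ 1
    (All.map (λ (lo , hi) → lo , ≤-trans (≤-pred hi) (s≤s (m≤m+n ℓ ℓ))) (stair-range 1 1 ℓ))
    (trans (cong (eval (v-word ℓ)) (trans (cong (_+ 1) (length-v ℓ)) (+-comm ℓ 1))) (eval-descent ℓ))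

  -- 2·T(n) = n(n+1), whence ℓ⁴ ≤ 4·T(ℓ)².
  double-tri : ∀ n → 2 * tri n ≡ n * suc n
  double-tri zero = refl
  double-tri (suc n) = trans (distrib n (tri n)) (trans (cong (2 * suc n +_) (double-tri n)) (close n))
    where
    distrib : ∀ n t → 2 * (suc n + t) ≡ 2 * suc n + 2 * t
    distrib = solve-∀
    close : ∀ n → 2 * suc n + n * suc n ≡ suc n * suc (suc n)
    close = solve-∀

  quartic-bound : ∀ ℓ → ℓ ^ 4 ≤ tri ℓ * tri ℓ * 4
  quartic-bound ℓ = subst₂ _≤_ (fourth ℓ) (square (tri ℓ))
    (subst (λ z → (ℓ * ℓ) * (ℓ * ℓ) ≤ z * z) (sym (double-tri ℓ)) (*-mono-≤ ℓ²≤ ℓ²≤))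
    where
    ℓ²≤ : ℓ * ℓ ≤ ℓ * suc ℓ
    ℓ²≤ = *-mono-≤ (≤-refl {ℓ}) (n≤1+n ℓ)
    -- the right-hand side is x ^ 4 unfolded
    fourth : ∀ x → (x * x) * (x * x) ≡ x * (x * (x * (x * 1)))
    fourth = solve-∀
    square : ∀ t → (2 * t) * (2 * t) ≡ t * t * 4
    square = solve-∀

  quartic-pair : ∀ ℓ → ∃[ n ] ∃[ u ] ∃[ v ] (Reduced n u × Reduced n v × length u ≡ ℓ × length v ≡ ℓ ×
                                            ∃[ k ] (RC u v k × ℓ ^ 4 ≤ k * 4))
  quartic-pair ℓ =
    suc (ℓ + ℓ) , u-word ℓ , v-word ℓ ,
    u-reduced ℓ , v-reduced ℓ , length-asc (suc ℓ) ℓ , length-v ℓ ,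
    tri ℓ * tri ℓ , grid⇒RC (proj₂ (staircase 1 ℓ ℓ)) , quartic-bound ℓ

open Construction using (quartic-pair)

open import Data.Nat using (ℕ; _^_)
import Data.Nat as ℕ
open import Data.Integer using (+_)
import Data.Integer as ℤ
import Data.Integer.Properties as ℤ
open import Data.Rational using (0ℚ; _<_; _≤_; _*_; _/_)
import Data.Rational as ℚ
open import Data.Rational.Properties using (toℚᵘ-cancel-≤; toℚᵘ-homo-*; toℚᵘ-fromℚᵘ)
import Data.Rational.Unnormalised as ℚᵘ
import Data.Rational.Unnormalised.Properties as ℚᵘ
open import Data.List using (length)
open import Data.Product using (_×_; _,_; ∃-syntax)
open import Relation.Binary.PropositionalEquality using (_≡_; sym; trans; subst₂)

quarter-bound : ∀ N k → N ℕ.≤ k ℕ.* 4 → (+ 1 / 4) * (+ N / 1) ≤ + k / 1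
quarter-bound N k h = toℚᵘ-cancel-≤
  (ℚᵘ.≤-respʳ-≃ (ℚᵘ.≃-sym (toℚᵘ-fromℚᵘ (ℚᵘ.mkℚᵘ (+ k) 0)))
    (ℚᵘ.≤-respˡ-≃ (ℚᵘ.≃-sym (ℚᵘ.≃-trans (toℚᵘ-homo-* (+ 1 / 4) (+ N / 1))
                                         (ℚᵘ.*-congˡ {ℚᵘ.mkℚᵘ (+ 1) 3} (toℚᵘ-fromℚᵘ (ℚᵘ.mkℚᵘ (+ N) 0)))))
      (ℚᵘ.*≤* cross)))
  where
  cross : (+ 1 ℤ.* + N) ℤ.* + 1 ℤ.≤ + k ℤ.* + 4
  cross = subst₂ ℤ._≤_ (sym (trans (ℤ.*-identityʳ _) (ℤ.*-identityˡ _))) (ℤ.pos-* k 4) (ℤ.+≤+ h)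

quarter-positive : 0ℚ < + 1 / 4
quarter-positive = ℚ.*<* (ℤ.+<+ (ℕ.s≤s ℕ.z≤n))

proposition2 : ∃[ C₃ ] (0ℚ < C₃ × (∀ (ℓ : ℕ) → ∃[ n ] ∃[ u ] ∃[ v ] (Reduced n u × Reduced n v × length u ≡ ℓ × length v ≡ ℓ × ∃[ k ] (RC u v k × C₃ * (+ (ℓ ^ 4) / 1) ≤ + k / 1))))
proposition2 = + 1 / 4 , quarter-positive , λ ℓ →
  let n , u , v , u-red , v-red , |u| , |v| , k , rc , ℓ⁴≤4k = quartic-pair ℓ
  in n , u , v , u-red , v-red , |u| , |v| , k , rc , quarter-bound (ℓ ^ 4) k ℓ⁴≤4k
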